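{- Let each $i\in[n]$ be designated an up index or a down index. A join-irreducible element $\gamma$ of the weak order on $S_n$ avoids both patterns $\overset{\uparrow}{2}13$ and $13\underset{\downarrow}{2}$ if and only if its corresponding subset is $A_{k,l}$ for some $1\le k\le l\le n-1$, where $A_{k,k}=[1,k]$ and, for $k<l$, writing $U=\{i\in[k+1,l]: i\text{ up}\}$, $A_{k,l}=[1,k]\cup U\cup[l+1,n]$ if $k+1$ and $l$ are down; $A_{k,l}=U\cup[l+1,n]$ if $k+1$ is up and $l$ is down; $A_{k,l}=[1,k]\cup U$ if $k+1$ is down and $l$ is up; $A_{k,l}=U$ if $k+1$ and $l$ are up.
   Context: Permutations are written in one-line notation $x_1\cdots x_n$. Weak order: $x\le y$ iff $I(x)\subseteq I(y)$, $I(x)=\{(x_j,x_i):i<j,\ x_i>x_j\}$. Join-irreducible elements of the weak order (those covering exactly one element) correspond bijectively to subsets $A\subseteq[n]$ with $\max([n]\setminus A)>\min A$: the permutation $\gamma$ lists the elements of $[n]\setminus A$ in increasing order followed by those of $A$ in increasing order. $x$ contains $\overset{\uparrow}{2}13$ if there are $i<j<k$ with $x_j<x_i<x_k$ and $x_i$ an up index; $x$ contains $13\underset{\downarrow}{2}$ if there are $i<j<k$ with $x_i<x_k<x_j$ and $x_k$ a down index; otherwise $x$ avoids them. $[a,b]$ denotes $\{a,a+1,\dots,b\}$. -}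

module Defs where

open import Data.Nat using (ℕ; zero; suc; _≤_; _<_; _≤ᵇ_; _<ᵇ_; _≡ᵇ_)
open import Data.Bool using (Bool; true; false; not; _∧_; _∨_; if_then_else_)
open import Data.List using (List; map; upTo; filter; _++_; length; lookup)
open import Data.Fin using (Fin)
import Data.Fin as F
open import Data.Product using (Σ; _×_; ∃-syntax)
open import Relation.Binary.PropositionalEquality using (_≡_)
open import Relation.Nullary using (¬_)
open import Relation.Nullary.Decidable using (does)

-- Values of [n] = {1,…,n} are natural numbers; a subset of [n] and an
-- up/down designation are Boolean predicates on ℕ, only their values on
-- [1,n] being relevant.  (up i ≡ true means i is an up index,
-- up i ≡ false means i is a down index.)

range : ℕ → List ℕ
range n = map suc (upTo n)

-- A ⊆ [n] corresponds to a join-irreducible: max([n]∖A) > min A,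
-- i.e. some a ∈ [n]∖A exceeds some b ∈ A.
JISubset : ℕ → (ℕ → Bool) → Set
JISubset n A = ∃[ a ] ∃[ b ] (1 ≤ b × b < a × a ≤ n × A a ≡ false × A b ≡ true)

-- the join-irreducible permutation γ_A in one-line notation:
-- elements of [n]∖A increasing, then elements of A increasing
γ : ℕ → (ℕ → Bool) → List ℕ
γ n A = filter (λ i → Data.Bool._≟_ (A i) false) (range n)
     ++ filter (λ i → Data.Bool._≟_ (A i) true) (range n)

Contains2↑13 : (ℕ → Bool) → List ℕ → Set
Contains2↑13 up x = ∃[ i ] ∃[ j ] ∃[ k ]
  (i F.< j × j F.< k × lookup x j < lookup x i × lookup x i < lookup x k
   × up (lookup x i) ≡ true)

Contains132↓ : (ℕ → Bool) → List ℕ → Set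
Contains132↓ up x = ∃[ i ] ∃[ j ] ∃[ k ]
  (i F.< j × j F.< k × lookup x i < lookup x k × lookup x k < lookup x j
   × up (lookup x k) ≡ false)

AvoidsBoth : (ℕ → Bool) → List ℕ → Set
AvoidsBoth up x = ¬ Contains2↑13 up x × ¬ Contains132↓ up x

-- the subset A_{k,l} (as a predicate; intersected with [1,n] via SameOn)
-- k = l : [1,k]
-- k < l : ([1,k] if k+1 down) ∪ U ∪ ([l+1,n] if l down),
--         U = {i ∈ [k+1,l] : i up}
A : (ℕ → Bool) → ℕ → ℕ → ℕ → Bool
A up k l i =
  if k ≡ᵇ l then i ≤ᵇ k
  else ((not (up (suc k)) ∧ (i ≤ᵇ k))
        ∨ ((k <ᵇ i) ∧ (i ≤ᵇ l) ∧ up i)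
        ∨ (not (up l) ∧ (l <ᵇ i)))

SameOn : ℕ → (ℕ → Bool) → (ℕ → Bool) → Set
SameOn n P Q = ∀ i → 1 ≤ i → i ≤ n → P i ≡ Q i

{-# OPTIONS --safe #-}
module Submission where

open import Defs
open import Data.Nat using (ℕ; _≤_; _∸_)
open import Data.Bool using (Bool)
open import Data.Product using (_×_; ∃-syntax)
open import Function.Bundles using (_⇔_)

open import Data.Nat using (zero; suc; _<_; _≤ᵇ_; _<ᵇ_; _≡ᵇ_; z≤n; s≤s)
open import Data.Nat.Properties
open import Data.Nat.Induction using (<-rec)
open import Data.Bool using (true; false; not) renaming (_≟_ to _≟ᵇ_)
open import Data.Bool.Properties using (¬-not; not-injective; ∧-identityʳ; ∧-zeroʳ; ∨-identityʳ)
open import Data.Empty using (⊥-elim)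
open import Data.Sum using (_⊎_; inj₁; inj₂; [_,_]′)
open import Data.Product using (_,_; proj₁; proj₂)
open import Data.Fin using (Fin)
import Data.Fin as F
import Data.Fin.Properties as FP
open import Data.List using (length; lookup; filter)
open import Data.List.Relation.Unary.All as All using (All; []; _∷_)
open import Data.List.Relation.Unary.All.Properties using (all-filter)
open import Data.List.Relation.Unary.AllPairs as AllPairs using (AllPairs; []; _∷_)
import Data.List.Relation.Unary.AllPairs.Properties as AllPairsₚ
open import Data.List.Relation.Unary.Any using (index)
open import Data.List.Relation.Unary.Any.Properties using (lookup-index)
open import Data.List.Membership.Propositional using (_∈_)
open import Data.List.Membership.Propositional.Properties
open import Function using (_∘_; id)
open import Function.Bundles using (mk⇔; Equivalence)
open import Relation.Binary using (Rel; Asymmetric; tri<; tri≈; tri>)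
open import Relation.Binary.PropositionalEquality
open import Relation.Nullary using (¬_; yes; no; ¬?)
open import Relation.Nullary.Decidable using (dec-true; dec-false; decidable-stable)
open import Relation.Unary using (Pred; Decidable)

-- Since γ_S lists [n]∖S and then S, each in increasing order, an occurrence of ↑213 in
-- γ_S amounts to an up index outside S lying strictly between two elements of S, and one
-- of 13↓2 to a down index in S lying strictly between two elements outside S.  Hence γ_S
-- avoids both patterns iff every i straddled by elements of the opposite membership has
-- S i = up i.  For join-irreducible S let [1,k] and [l+1,n] be the maximal initial and
-- final intervals on which S is constant: every i ∈ [k+1,l] is straddled, so S follows
-- the designation there, and this block structure is exactly A_{k,l}.  Conversely, in
-- this block structure only elements of [k+1,l] can be straddled.

-- These rely on does (m ≤? n) etc. being definitionally m ≤ᵇ n, the boolean tests used in A.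
≤ᵇ-true : ∀ {m n} → m ≤ n → (m ≤ᵇ n) ≡ true
≤ᵇ-true {m} {n} = dec-true (m ≤? n)

≤ᵇ-false : ∀ {m n} → n < m → (m ≤ᵇ n) ≡ false
≤ᵇ-false {m} {n} = dec-false (m ≤? n) ∘ <⇒≱

<ᵇ-true : ∀ {m n} → m < n → (m <ᵇ n) ≡ true
<ᵇ-true {m} {n} = dec-true (m <? n)

<ᵇ-false : ∀ {m n} → n ≤ m → (m <ᵇ n) ≡ false
<ᵇ-false {m} {n} = dec-false (m <? n) ∘ ≤⇒≯

≡ᵇ-true : ∀ {m n} → m ≡ n → (m ≡ᵇ n) ≡ true
≡ᵇ-true {m} {n} = dec-true (m ≟ n)

≡ᵇ-false : ∀ {m n} → m ≢ n → (m ≡ᵇ n) ≡ false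
≡ᵇ-false {m} {n} = dec-false (m ≟ n)

≤∸1⇒< : ∀ {m n} → 1 ≤ m → m ≤ n ∸ 1 → m < n
≤∸1⇒< {n = suc n} _ m≤n = s≤s m≤n
≤∸1⇒< {n = zero} (s≤s _) ()

<⇒≤∸1 : ∀ {m n} → m < n → m ≤ n ∸ 1
<⇒≤∸1 (s≤s m≤n) = m≤n

≢-by : ∀ {x y b : Bool} → x ≡ b → y ≡ not b → x ≢ y
≢-by {b = true} refl refl ()
≢-by {b = false} refl refl ()

module _ {p} {P : Pred ℕ p} (P? : Decidable P) where

  least : ∀ {m} → P m → ∃[ k ] (k ≤ m × P k × (∀ {i} → i < k → ¬ P i))
  least {m} = <-rec (λ m → P m → ∃[ k ] (k ≤ m × P k × (∀ {i} → i < k → ¬ P i))) search m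
    where
    search : ∀ m → (∀ {i} → i < m → P i → ∃[ k ] (k ≤ i × P k × (∀ {j} → j < k → ¬ P j))) →
             P m → ∃[ k ] (k ≤ m × P k × (∀ {i} → i < k → ¬ P i))
    search m below pm with anyUpTo? P? m
    ... | yes (i , i<m , pi) = let k , k≤i , rest = below i<m pi in k , ≤-trans k≤i (<⇒≤ i<m) , rest
    ... | no none = m , ≤-refl , pm , λ i<m pi → none (_ , i<m , pi)

  greatestBelow : ∀ {m} y → P m → m < y → ∃[ l ] (l < y × P l × (∀ {i} → l < i → i < y → ¬ P i))
  greatestBelow (suc y) pm m<1+y with P? y
  ... | yes py = y , ≤-refl , py , λ y<i i<1+y → ⊥-elim (<⇒≱ y<i (≤-pred i<1+y))
  ... | no ¬py with greatestBelow y pm (≤∧≢⇒< (≤-pred m<1+y) λ { refl → ¬py pm })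
  ...   | l , l<y , pl , above = l , m≤n⇒m≤1+n l<y , pl , λ {i} l<i i<1+y →
            [ above l<i , (λ { refl → ¬py }) ]′ (m≤n⇒m<n∨m≡n (≤-pred i<1+y))

module _ {a r} {X : Set a} {R : Rel X r} where

  lookup-AllPairs : ∀ {xs} → AllPairs R xs → ∀ {i j : Fin (length xs)} → i F.< j →
                    R (lookup xs i) (lookup xs j)
  lookup-AllPairs (Rx ∷ _) {F.zero} {F.suc j} _ = All.lookup Rx (∈-lookup j)
  lookup-AllPairs (_ ∷ Rxs) {F.suc i} {F.suc j} (s≤s i<j) = lookup-AllPairs Rxs i<j

  lookup-AllPairs⁻ : Asymmetric R → ∀ {xs} → AllPairs R xs → ∀ {i j : Fin (length xs)} →
                     R (lookup xs i) (lookup xs j) → i F.< j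
  lookup-AllPairs⁻ asym sorted {i} {j} r with FP.<-cmp i j
  ... | tri< i<j _ _ = i<j
  ... | tri≈ _ refl _ = ⊥-elim (asym r r)
  ... | tri> _ _ j<i = ⊥-elim (asym r (lookup-AllPairs sorted j<i))

  AllPairs-mapWithAll : ∀ {q r′} {P : Pred X q} {R′ : Rel X r′} →
                        (∀ {x y} → P x → P y → R x y → R′ x y) →
                        ∀ {xs} → All P xs → AllPairs R xs → AllPairs R′ xs
  AllPairs-mapWithAll f [] [] = []
  AllPairs-mapWithAll f (px ∷ pxs) (Rx ∷ Rxs) =
    All.zipWith (λ (py , r) → f px py r) (pxs , Rx) ∷ AllPairs-mapWithAll f pxs Rxs

A-diagonal : ∀ up k i → A up k k i ≡ (i ≤ᵇ k)
A-diagonal up k i rewrite ≡ᵇ-true (refl {x = k}) = refl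

module _ (up : ℕ → Bool) {k l : ℕ} where

  A-middle : ∀ {i} → k < i → i ≤ l → A up k l i ≡ up i
  A-middle {i} k<i i≤l
    rewrite ≡ᵇ-false (<⇒≢ (<-≤-trans k<i i≤l)) | ≤ᵇ-false k<i | <ᵇ-true k<i | ≤ᵇ-true i≤l | <ᵇ-false i≤l
          | ∧-zeroʳ (not (up (suc k))) | ∧-zeroʳ (not (up l)) = ∨-identityʳ (up i)

  A-left : k ≤ l → ∀ {i} → i ≤ k → A up k l i ≡ not (A up k l (suc k))
  A-left k≤l {i} i≤k with k ≟ l
  ... | yes refl
    rewrite A-diagonal up k i | A-diagonal up k (suc k) | ≤ᵇ-true i≤k | ≤ᵇ-false (n<1+n k) = refl
  ... | no k≢l
    rewrite A-middle {suc k} ≤-refl (≤∧≢⇒< k≤l k≢l) | ≡ᵇ-false k≢l | ≤ᵇ-true i≤k | <ᵇ-false i≤k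
          | <ᵇ-false (≤-trans i≤k k≤l) | ∧-identityʳ (not (up (suc k))) | ∧-zeroʳ (not (up l)) =
    ∨-identityʳ (not (up (suc k)))

  A-right : k ≤ l → ∀ {i} → l < i → A up k l i ≡ not (A up k l l)
  A-right k≤l {i} l<i with k ≟ l
  ... | yes refl
    rewrite A-diagonal up k i | A-diagonal up k k | ≤ᵇ-false l<i | ≤ᵇ-true (≤-refl {k}) = refl
  ... | no k≢l
    rewrite A-middle {l} (≤∧≢⇒< k≤l k≢l) ≤-refl | ≡ᵇ-false k≢l | ≤ᵇ-false (≤-<-trans k≤l l<i)
          | <ᵇ-true (≤-<-trans k≤l l<i) | ≤ᵇ-false l<i | <ᵇ-true l<i | ∧-zeroʳ (not (up (suc k))) =
    ∧-identityʳ (not (up l))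

Straddled : ℕ → (ℕ → Bool) → ℕ → Set
Straddled n S i = (∃[ j ] (1 ≤ j × j < i × S j ≢ S i)) × (∃[ j ] (i < j × j ≤ n × S j ≢ S i))

Misfit : ℕ → (ℕ → Bool) → (ℕ → Bool) → Set
Misfit n up S = ∃[ i ] (Straddled n S i × up i ≢ S i)

-- The block structure of A_{k,l}, phrased through S itself so that it covers k = l and
-- k < l alike.
record Layout (n : ℕ) (up S : ℕ → Bool) (k l : ℕ) : Set where
  field
    left   : ∀ {i} → 1 ≤ i → i ≤ k → S i ≡ not (S (suc k))
    middle : ∀ {i} → k < i → i ≤ l → S i ≡ up i
    right  : ∀ {i} → l < i → i ≤ n → S i ≡ not (S l)

open Layout

module _ {n : ℕ} {up S : ℕ → Bool} {k l : ℕ} where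

  layout⇒¬misfit : Layout n up S k l → ¬ Misfit n up S
  layout⇒¬misfit L (i , ((j , 1≤j , j<i , Sj≢Si) , (j′ , i<j′ , j′≤n , Sj′≢Si)) , up≢S)
    with i ≤? k | l <? i
  ... | yes i≤k | _ =
    Sj≢Si (trans (left L 1≤j (≤-trans (<⇒≤ j<i) i≤k)) (sym (left L (≤-trans 1≤j (<⇒≤ j<i)) i≤k)))
  ... | no _ | yes l<i =
    Sj′≢Si (trans (right L (<-trans l<i i<j′) j′≤n) (sym (right L l<i (≤-trans (<⇒≤ i<j′) j′≤n))))
  ... | no i≰k | no l≮i = up≢S (sym (middle L (≰⇒> i≰k) (≮⇒≥ l≮i)))

  sameOn-A⇒layout : 1 ≤ k → k ≤ l → l ≤ n ∸ 1 → SameOn n S (A up k l) → Layout n up S k l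
  sameOn-A⇒layout 1≤k k≤l l≤n∸1 S≈A = record
    { left   = λ {i} 1≤i i≤k → begin
        S i                    ≡⟨ S≈A i 1≤i (≤-trans i≤k (<⇒≤ k<n)) ⟩
        A up k l i             ≡⟨ A-left up k≤l i≤k ⟩
        not (A up k l (suc k)) ≡⟨ cong not (S≈A (suc k) (s≤s z≤n) k<n) ⟨
        not (S (suc k))        ∎
    ; middle = λ {i} k<i i≤l →
        trans (S≈A i (≤-trans 1≤k (<⇒≤ k<i)) (≤-trans i≤l (<⇒≤ l<n))) (A-middle up k<i i≤l)
    ; right  = λ {i} l<i i≤n → begin
        S i              ≡⟨ S≈A i (≤-trans 1≤k (<⇒≤ (≤-<-trans k≤l l<i))) i≤n ⟩
        A up k l i       ≡⟨ A-right up k≤l l<i ⟩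
        not (A up k l l) ≡⟨ cong not (S≈A l (≤-trans 1≤k k≤l) (<⇒≤ l<n)) ⟨
        not (S l)        ∎
    }
    where
    open ≡-Reasoning
    l<n : l < n
    l<n = ≤∸1⇒< (≤-trans 1≤k k≤l) l≤n∸1
    k<n : k < n
    k<n = ≤-<-trans k≤l l<n

module _ {n : ℕ} {S : ℕ → Bool} where

  JISubset-differs : JISubset n S → ∀ c → ∃[ w ] (1 ≤ w × w ≤ n × S w ≢ c)
  JISubset-differs (a , b , 1≤b , b<a , a≤n , Sa , Sb) true = a , ≤-trans 1≤b (<⇒≤ b<a) , a≤n , ≢-by Sa refl
  JISubset-differs (a , b , 1≤b , b<a , a≤n , Sa , Sb) false = b , 1≤b , ≤-trans (<⇒≤ b<a) a≤n , ≢-by Sb refl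

  JISubset-initialBlock : JISubset n S → ∀ {k c} → (∀ {i} → 1 ≤ i → i ≤ k → S i ≡ c) →
                          (∀ {i} → k < i → i ≤ n → S i ≡ not c) → c ≡ true
  JISubset-initialBlock (a , b , 1≤b , b<a , a≤n , Sa , Sb) {k} before after with b ≤? k
  ... | yes b≤k = trans (sym (before 1≤b b≤k)) Sb
  ... | no b≰k = not-injective (trans (sym (after (<-trans (≰⇒> b≰k) b<a) a≤n)) Sa)

  firstChange : JISubset n S → ∃[ k ] (1 ≤ k × k < n × (∀ {i} → 1 ≤ i → i ≤ k → S i ≡ S 1) × S (suc k) ≢ S 1)
  firstChange ji with JISubset-differs ji (S 1)
  ... | suc w , _ , 1+w≤n , S[1+w]≢S1 with least (λ i → ¬? (S (suc i) ≟ᵇ S 1)) S[1+w]≢S1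
  ...   | zero , _ , S1≢S1 , _ = ⊥-elim (S1≢S1 refl)
  ...   | k@(suc _) , k≤w , change , before = k , s≤s z≤n , <-≤-trans (s≤s k≤w) 1+w≤n , constant , change
    where
    constant : ∀ {i} → 1 ≤ i → i ≤ k → S i ≡ S 1
    constant {suc i} _ 1+i≤k = decidable-stable (S (suc i) ≟ᵇ S 1) (before 1+i≤k)

  lastChange : JISubset n S → ∃[ l ] (l < n × (∀ {i} → l < i → i ≤ n → S i ≡ S n) × S l ≢ S n)
  lastChange ji with JISubset-differs ji (S n)
  ... | w , _ , w≤n , Sw≢Sn
    with greatestBelow (λ i → ¬? (S i ≟ᵇ S n)) n Sw≢Sn (≤∧≢⇒< w≤n λ { refl → Sw≢Sn refl })
  ...   | l , l<n , change , after = l , l<n , constant , change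
    where
    constant : ∀ {i} → l < i → i ≤ n → S i ≡ S n
    constant {i} l<i i≤n with m≤n⇒m<n∨m≡n i≤n
    ... | inj₁ i<n = decidable-stable (S i ≟ᵇ S n) (after l<i i<n)
    ... | inj₂ refl = refl

differs-before : ∀ {S : ℕ → Bool} {a b i} → 1 ≤ a → a < b → b ≤ i → S a ≢ S b →
                 ∃[ j ] (1 ≤ j × j < i × S j ≢ S i)
differs-before {S} {a} {b} {i} 1≤a a<b b≤i Sa≢Sb with S a ≟ᵇ S i
... | no Sa≢Si = a , 1≤a , <-≤-trans a<b b≤i , Sa≢Si
... | yes Sa≡Si = b , ≤-trans 1≤a (<⇒≤ a<b) , ≤∧≢⇒< b≤i (λ { refl → Sa≢Sb Sa≡Si }) ,
                  λ Sb≡Si → Sa≢Sb (trans Sa≡Si (sym Sb≡Si))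

differs-after : ∀ {n} {S : ℕ → Bool} {a b i} → i ≤ a → a < b → b ≤ n → S a ≢ S b →
                ∃[ j ] (i < j × j ≤ n × S j ≢ S i)
differs-after {S = S} {a} {b} {i} i≤a a<b b≤n Sa≢Sb with S b ≟ᵇ S i
... | no Sb≢Si = b , ≤-<-trans i≤a a<b , b≤n , Sb≢Si
... | yes Sb≡Si = a , ≤∧≢⇒< i≤a (λ { refl → Sa≢Sb (sym Sb≡Si) }) , ≤-trans (<⇒≤ a<b) b≤n ,
                  λ Sa≡Si → Sa≢Sb (trans Sa≡Si (sym Sb≡Si))

module _ {n : ℕ} {up S : ℕ → Bool} {k l : ℕ} where

  -- For k = l a layout leaves open whether S is [1,k] or [k+1,n]; join-irreducibility
  -- excludes the second.
  layout-boundary : JISubset n S → 1 ≤ k → k ≤ l → Layout n up S k l →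
                    S (suc k) ≡ A up k l (suc k) × S l ≡ A up k l l
  layout-boundary ji 1≤k k≤l L with k ≟ l
  ... | no k≢l = trans (middle L (n<1+n k) k<l) (sym (A-middle up (n<1+n k) k<l)) ,
                 trans (middle L k<l ≤-refl) (sym (A-middle up k<l ≤-refl))
    where
    k<l : k < l
    k<l = ≤∧≢⇒< k≤l k≢l
  ... | yes refl
    rewrite A-diagonal up k (suc k) | A-diagonal up k k | ≤ᵇ-false (n<1+n k) | ≤ᵇ-true (≤-refl {k}) =
    not-injective {y = false} initial , trans (left L 1≤k ≤-refl) initial
    where
    initial : not (S (suc k)) ≡ true
    initial = JISubset-initialBlock ji (left L) λ k<i i≤n →
      trans (right L k<i i≤n) (cong not (left L 1≤k ≤-refl))

  layout⇒sameOn-A : JISubset n S → 1 ≤ k → k ≤ l → Layout n up S k l → SameOn n S (A up k l)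
  layout⇒sameOn-A ji 1≤k k≤l L i 1≤i i≤n with i ≤? k | l <? i | layout-boundary ji 1≤k k≤l L
  ... | yes i≤k | _ | S≈A[1+k] , _ = begin
    S i                    ≡⟨ left L 1≤i i≤k ⟩
    not (S (suc k))        ≡⟨ cong not S≈A[1+k] ⟩
    not (A up k l (suc k)) ≡⟨ A-left up k≤l i≤k ⟨
    A up k l i             ∎
    where open ≡-Reasoning
  ... | no _ | yes l<i | _ , S≈A[l] = begin
    S i              ≡⟨ right L l<i i≤n ⟩
    not (S l)        ≡⟨ cong not S≈A[l] ⟩
    not (A up k l l) ≡⟨ A-right up k≤l l<i ⟨
    A up k l i       ∎
    where open ≡-Reasoning
  ... | no i≰k | no l≮i | _ =
    trans (middle L (≰⇒> i≰k) (≮⇒≥ l≮i)) (sym (A-middle up (≰⇒> i≰k) (≮⇒≥ l≮i)))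

¬misfit⇒sameOn-A : ∀ {n up S} → JISubset n S → ¬ Misfit n up S →
                   ∃[ k ] ∃[ l ] (1 ≤ k × k ≤ l × l ≤ n ∸ 1 × SameOn n S (A up k l))
¬misfit⇒sameOn-A {n} {up} {S} ji ¬misfit with firstChange ji | lastChange ji
... | k , 1≤k , k<n , leftConst , S[1+k]≢S1 | l , l<n , rightConst , Sl≢Sn =
  k , l , 1≤k , k≤l , <⇒≤∸1 l<n , layout⇒sameOn-A ji 1≤k k≤l layout
  where
  open ≡-Reasoning
  k≤l : k ≤ l
  k≤l = ≮⇒≥ λ l<k → S[1+k]≢S1 (begin
    S (suc k) ≡⟨ rightConst (<-trans l<k (n<1+n k)) k<n ⟩
    S n       ≡⟨ rightConst (n<1+n l) l<n ⟨
    S (suc l) ≡⟨ leftConst (s≤s z≤n) l<k ⟩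
    S 1       ∎)
  straddled : ∀ {i} → k < i → i ≤ l → Straddled n S i
  straddled k<i i≤l = differs-before (≤-refl {1}) (s≤s 1≤k) k<i (≢-sym S[1+k]≢S1) ,
                      differs-after i≤l l<n ≤-refl Sl≢Sn
  layout : Layout n up S k l
  layout = record
    { left   = λ 1≤i i≤k → trans (leftConst 1≤i i≤k) (¬-not (≢-sym S[1+k]≢S1))
    ; middle = λ {i} k<i i≤l →
        sym (decidable-stable (up i ≟ᵇ S i) λ up≢S → ¬misfit (i , straddled k<i i≤l , up≢S))
    ; right  = λ l<i i≤n → trans (rightConst l<i i≤n) (¬-not (≢-sym Sl≢Sn))
    }

range-sorted : ∀ n → AllPairs _<_ (range n)
range-sorted n = AllPairsₚ.map⁺ (AllPairs.map s≤s (AllPairsₚ.applyUpTo⁺₁ id n (λ i<j _ → i<j)))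

∈-range⁻ : ∀ {n v} → v ∈ range n → 1 ≤ v × v ≤ n
∈-range⁻ v∈ with ∈-map⁻ suc v∈
... | _ , u∈ , refl = s≤s z≤n , ∈-upTo⁻ u∈

∈-range⁺ : ∀ {n v} → 1 ≤ v → v ≤ n → v ∈ range n
∈-range⁺ {v = suc _} _ v≤n = ∈-map⁺ suc (∈-upTo⁺ v≤n)

module _ {n : ℕ} {S : ℕ → Bool} where

  _≺_ : Rel ℕ _
  a ≺ b = (S a ≡ false × S b ≡ true) ⊎ (S a ≡ S b × a < b)

  ≺-asym : Asymmetric _≺_
  ≺-asym (inj₁ (_ , Sb)) (inj₁ (Sb′ , _)) = ≢-by Sb Sb′ refl
  ≺-asym (inj₁ (Sa , Sb)) (inj₂ (Sb≡Sa , _)) = ≢-by Sb Sa Sb≡Sa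
  ≺-asym (inj₂ (Sa≡Sb , _)) (inj₁ (Sb , Sa)) = ≢-by Sa Sb Sa≡Sb
  ≺-asym (inj₂ (_ , a<b)) (inj₂ (_ , b<a)) = <-asym a<b b<a

  ≺-descent : ∀ {a b} → a ≺ b → b < a → S a ≡ false × S b ≡ true
  ≺-descent (inj₁ Sa,Sb) _ = Sa,Sb
  ≺-descent (inj₂ (_ , a<b)) b<a = ⊥-elim (<-asym a<b b<a)

  ≺-upward : ∀ {a b} → a ≺ b → S a ≡ true → S b ≡ true
  ≺-upward (inj₁ (_ , Sb)) _ = Sb
  ≺-upward (inj₂ (Sa≡Sb , _)) Sa = trans (sym Sa≡Sb) Sa

  ≺-downward : ∀ {a b} → a ≺ b → S b ≡ false → S a ≡ false
  ≺-downward (inj₁ (Sa , _)) _ = Sa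
  ≺-downward (inj₂ (Sa≡Sb , _)) Sb = trans Sa≡Sb Sb

  γ-sorted : AllPairs _≺_ (γ n S)
  γ-sorted = AllPairsₚ.++⁺ (block false) (block true)
    (All.map (λ Sx → All.map (λ Sy → inj₁ (Sx , Sy)) (all-filter _ (range n))) (all-filter _ (range n)))
    where
    block : ∀ b → AllPairs _≺_ (filter (λ i → S i ≟ᵇ b) (range n))
    block b = AllPairs-mapWithAll (λ Sx Sy x<y → inj₂ (trans Sx (sym Sy) , x<y))
                (all-filter _ (range n)) (AllPairsₚ.filter⁺ _ (range-sorted n))

  ∈-γ⁻ : ∀ {v} → v ∈ γ n S → 1 ≤ v × v ≤ n
  ∈-γ⁻ = ∈-range⁻ ∘ [ proj₁ ∘ ∈-filter⁻ _ , proj₁ ∘ ∈-filter⁻ _ ]′ ∘ ∈-++⁻ _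

  ∈-γ⁺ : ∀ {v} → 1 ≤ v → v ≤ n → v ∈ γ n S
  ∈-γ⁺ {v} 1≤v v≤n with S v in Sv
  ... | false = ∈-++⁺ˡ (∈-filter⁺ _ (∈-range⁺ 1≤v v≤n) Sv)
  ... | true = ∈-++⁺ʳ _ (∈-filter⁺ _ (∈-range⁺ 1≤v v≤n) Sv)

  position : ∀ {v} → 1 ≤ v → v ≤ n → ∃[ p ] (lookup (γ n S) p ≡ v)
  position 1≤v v≤n = let v∈γ = ∈-γ⁺ 1≤v v≤n in index v∈γ , sym (lookup-index v∈γ)

  private
    x : Fin (length (γ n S)) → ℕ
    x = lookup (γ n S)

    bounds : ∀ p → 1 ≤ x p × x p ≤ n
    bounds p = ∈-γ⁻ (∈-lookup p)

    ordered : ∀ {p q} → x p ≺ x q → p F.< q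
    ordered = lookup-AllPairs⁻ ≺-asym γ-sorted

  module _ {up : ℕ → Bool} where

    ↑213⇒misfit : Contains2↑13 up (γ n S) → Misfit n up S
    ↑213⇒misfit (p , q , r , p<q , q<r , xq<xp , xp<xr , up[xp]) =
      x p , ((x q , proj₁ (bounds q) , xq<xp , ≢-by Sxq Sxp) ,
             (x r , xp<xr , proj₂ (bounds r) , ≢-by Sxr Sxp)) ,
      ≢-by up[xp] Sxp
      where
      Sxp = proj₁ (≺-descent (lookup-AllPairs γ-sorted p<q) xq<xp)
      Sxq = proj₂ (≺-descent (lookup-AllPairs γ-sorted p<q) xq<xp)
      Sxr = ≺-upward (lookup-AllPairs γ-sorted q<r) Sxq

    13↓2⇒misfit : Contains132↓ up (γ n S) → Misfit n up S
    13↓2⇒misfit (p , q , r , p<q , q<r , xp<xr , xr<xq , up[xr]) =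
      x r , ((x p , proj₁ (bounds p) , xp<xr , ≢-by Sxp Sxr) ,
             (x q , xr<xq , proj₂ (bounds q) , ≢-by Sxq Sxr)) ,
      ≢-by up[xr] Sxr
      where
      Sxq = proj₁ (≺-descent (lookup-AllPairs γ-sorted q<r) xr<xq)
      Sxr = proj₂ (≺-descent (lookup-AllPairs γ-sorted q<r) xr<xq)
      Sxp = ≺-downward (lookup-AllPairs γ-sorted p<q) Sxq

    misfit⇒pattern : Misfit n up S → Contains2↑13 up (γ n S) ⊎ Contains132↓ up (γ n S)
    misfit⇒pattern (i , ((j , 1≤j , j<i , Sj≢Si) , (j′ , i<j′ , j′≤n , Sj′≢Si)) , up≢S)
      with S i in Si | position 1≤j (<⇒≤ (<-≤-trans (<-trans j<i i<j′) j′≤n))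
         | position (≤-trans 1≤j (<⇒≤ j<i)) (≤-trans (<⇒≤ i<j′) j′≤n)
         | position (≤-trans 1≤j (<⇒≤ (<-trans j<i i<j′))) j′≤n
    ... | false | pⱼ , refl | pᵢ , refl | pⱼ′ , refl =
      inj₁ (pᵢ , pⱼ , pⱼ′ , ordered (inj₁ (Si , ¬-not Sj≢Si)) , ordered (inj₂ (Sj≡Sj′ , <-trans j<i i<j′)) ,
            j<i , i<j′ , ¬-not up≢S)
      where Sj≡Sj′ = trans (¬-not Sj≢Si) (sym (¬-not Sj′≢Si))
    ... | true | pⱼ , refl | pᵢ , refl | pⱼ′ , refl =
      inj₂ (pⱼ , pⱼ′ , pᵢ , ordered (inj₂ (Sj≡Sj′ , <-trans j<i i<j′)) , ordered (inj₁ (¬-not Sj′≢Si , Si)) ,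
            j<i , i<j′ , ¬-not up≢S)
      where Sj≡Sj′ = trans (¬-not Sj≢Si) (sym (¬-not Sj′≢Si))

    avoidsBoth⇔¬misfit : AvoidsBoth up (γ n S) ⇔ (¬ Misfit n up S)
    avoidsBoth⇔¬misfit = mk⇔
      (λ (¬↑213 , ¬13↓2) → [ ¬↑213 , ¬13↓2 ]′ ∘ misfit⇒pattern)
      (λ ¬misfit → ¬misfit ∘ ↑213⇒misfit , ¬misfit ∘ 13↓2⇒misfit)

proposition9p3 : (n : ℕ) (up : ℕ → Bool) (S : ℕ → Bool) → JISubset n S →
    AvoidsBoth up (γ n S) ⇔
      (∃[ k ] ∃[ l ] (1 ≤ k × k ≤ l × l ≤ n ∸ 1 × SameOn n S (A up k l)))
proposition9p3 n up S ji = mk⇔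
  (¬misfit⇒sameOn-A ji ∘ to)
  (λ (k , l , 1≤k , k≤l , l≤n∸1 , S≈A) → from (layout⇒¬misfit (sameOn-A⇒layout {up = up} 1≤k k≤l l≤n∸1 S≈A)))
  where open Equivalence (avoidsBoth⇔¬misfit {up = up})
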